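{- Let $n\geq 2$ and let $D_n\subseteq\mathbb{Q}^n$ be topologically dense with no two distinct points colinear. If $\prec_1,\ldots,\prec_n$ are linear orders on $D_n$ whose intersection is the product order $<$ on $D_n$, then there are linear orders $\prec_1^*,\ldots,\prec_n^*$ on $\mathbb{Q}^n$ extending $\prec_1,\ldots,\prec_n$ respectively, whose intersection is the product order on $\mathbb{Q}^n$.
   Context: $\mathbb{Q}^n$ has the product topology and product order: $\mathbf{a}<\mathbf{b}$ iff $a_i\leq b_i$ for all $i$ and $\mathbf{a}\neq\mathbf{b}$. Colinear means sharing a coordinate. -}

module Defs where

open import Level using (0ℓ)
open import Data.Nat using (ℕ)
open import Data.Fin using (Fin)
open import Data.Rational using (ℚ) renaming (_≤_ to _≤ℚ_; _<_ to _<ℚ_)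
open import Data.Vec using (Vec; lookup)
open import Data.Product using (_×_; Σ-syntax; ∃-syntax)
open import Data.Sum using (_⊎_)
open import Data.Unit using (⊤)
open import Relation.Nullary using (¬_)
open import Relation.Binary.PropositionalEquality using (_≡_; _≢_)

Pt : ℕ → Set
Pt n = Vec ℚ n

Subset : ℕ → Set₁
Subset n = Pt n → Set

PtRel : ℕ → Set₁
PtRel n = Pt n → Pt n → Set

_<ₚ_ : ∀ {n} → Pt n → Pt n → Set
a <ₚ b = (∀ i → lookup a i ≤ℚ lookup b i) × (a ≢ b)

Colinear : ∀ {n} → Pt n → Pt n → Set
Colinear {n} a b = ∃[ i ] (lookup a i ≡ lookup b i)

NoTwoColinear : ∀ {n} → Subset n → Set
NoTwoColinear D = ∀ x y → D x → D y → x ≢ y → ¬ Colinear x y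

Dense : ∀ {n} → Subset n → Set
Dense {n} D = ∀ (a b : Pt n) → (∀ i → lookup a i <ℚ lookup b i) →
  ∃[ d ] (D d × (∀ i → (lookup a i <ℚ lookup d i) × (lookup d i <ℚ lookup b i)))

IsLinearOrderOn : ∀ {n} → Subset n → PtRel n → Set
IsLinearOrderOn S _≺_ =
    (∀ x → S x → ¬ (x ≺ x))
  × (∀ x y z → S x → S y → S z → x ≺ y → y ≺ z → x ≺ z)
  × (∀ x y → S x → S y → x ≢ y → (x ≺ y) ⊎ (y ≺ x))

Full : ∀ {n} → Subset n
Full _ = ⊤

-- Call (d , e) a j-inversion of D if e lies below d in coordinate j and above it in all the
-- others. Some ≺ᵢ reverses it (e ≺ᵢ d), since otherwise d <ₚ e. Density provides inversions in
-- every box, and a pigeonhole argument over the other n − 1 coordinates then shows that one and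
-- the same order ≺_(σ j) reverses all j-inversions, hence that ≺_(σ j) follows the j-th
-- coordinate on D; in particular σ is a permutation.
-- The extension of ≺_(σ j) is the lexicographic order comparing the j-th coordinate first: it
-- extends ≺_(σ j) because distinct points of D never share a coordinate, and these n
-- lexicographic orders intersect to the product order.
module Submission where

open import Defs
open import Data.Nat as ℕ using (ℕ; _≤_)
import Data.Nat.Properties as ℕ
open import Data.Fin using (Fin; zero; suc; punchIn; punchOut)
open import Data.Fin.Properties
  using (_≟_; any?; ¬∀⟶∃¬; punchOut-injective; punchIn-injective; punchInᵢ≢i; injective⇒≤)
open import Data.Rational using (ℚ; 0ℚ; 1ℚ; _+_; _-_; -_; _⊔_; _⊓_; _<_) renaming (_≤_ to _≤ℚ_)
import Data.Rational.Properties as ℚ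
open import Data.Vec using (Vec; []; _∷_; lookup; tabulate)
open import Data.Vec.Properties using (lookup∘tabulate; ∷-injectiveʳ)
open import Data.Vec.Functional using (updateAt)
open import Data.Vec.Functional.Properties using (updateAt-updates; updateAt-minimal)
open import Data.Vec.Relation.Binary.Lex.Strict as Lex using (Lex-<; this; next)
open import Data.Vec.Relation.Binary.Pointwise.Inductive using (Pointwise-≡⇒≡; ≡⇒Pointwise-≡)
open import Data.Product using (Σ; Σ-syntax; ∃-syntax; _×_; _,_; proj₁; proj₂)
open import Data.Sum as ⊎ using (_⊎_; inj₁; inj₂; [_,_]′)
open import Data.Empty using (⊥; ⊥-elim)
open import Function using (_∘_; id)
open import Function.Bundles using (_⇔_; mk⇔; Equivalence)
open import Function.Definitions using (Injective)
open import Relation.Binary.Bundles using (StrictTotalOrder)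
open import Relation.Binary.Definitions using (tri<; tri≈; tri>)
open import Relation.Binary.PropositionalEquality using (_≡_; _≢_; refl; sym; trans; cong; subst; subst₂)
open import Relation.Nullary using (¬_; Dec; yes; no; contradiction)
open import Relation.Nullary.Decidable using (decidable-stable)

injective⇒surjective : ∀ {n} {f : Fin n → Fin n} → Injective _≡_ _≡_ f → ∀ y → ∃[ x ] f x ≡ y
injective⇒surjective {ℕ.suc n} {f} f-injective y =
  decidable-stable (any? (λ x → f x ≟ y)) λ ∄x →
    let y≢f : ∀ x → y ≢ f x
        y≢f x y≡fx = ∄x (x , sym y≡fx)
    in ℕ.1+n≰n (injective⇒≤ {f = λ x → punchOut (y≢f x)}
                 (f-injective ∘ punchOut-injective (y≢f _) (y≢f _)))

p-1<p : ∀ p → p - 1ℚ < p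
p-1<p p = subst (p - 1ℚ <_) (ℚ.+-identityʳ p) (ℚ.+-monoʳ-< p (ℚ.negative⁻¹ (- 1ℚ)))

p<p+1 : ∀ p → p < p + 1ℚ
p<p+1 p = subst (_< p + 1ℚ) (ℚ.+-identityʳ p) (ℚ.+-monoʳ-< p (ℚ.positive⁻¹ 1ℚ))

<⇒≱ : ∀ {p q} → p < q → ¬ q ≤ℚ p
<⇒≱ p<q q≤p = ℚ.<-irrefl refl (ℚ.<-≤-trans p<q q≤p)

⊔-< : ∀ {p q r} → p < r → q < r → p ⊔ q < r
⊔-< {p} {q} p<r q<r with ℚ.⊔-sel p q
... | inj₁ p⊔q≡p = subst (_< _) (sym p⊔q≡p) p<r
... | inj₂ p⊔q≡q = subst (_< _) (sym p⊔q≡q) q<r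

<-⊓ : ∀ {p q r} → p < q → p < r → p < q ⊓ r
<-⊓ {q = q} {r} p<q p<r with ℚ.⊓-sel q r
... | inj₁ q⊓r≡q = subst (_ <_) (sym q⊓r≡q) p<q
... | inj₂ q⊓r≡r = subst (_ <_) (sym q⊓r≡r) p<r

module _ {n : ℕ} where

  _≪_ : (Fin n → ℚ) → (Fin n → ℚ) → Set
  u ≪ v = ∀ c → u c < v c

  _≪[_]_ : (Fin n → ℚ) → Fin n → (Fin n → ℚ) → Set
  u ≪[ j ] v = ∀ c → c ≢ j → u c < v c

  _⊔ᶠ_ _⊓ᶠ_ : (Fin n → ℚ) → (Fin n → ℚ) → Fin n → ℚ
  (u ⊔ᶠ v) c = u c ⊔ v c
  (u ⊓ᶠ v) c = u c ⊓ v c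

updateAt-≪ : ∀ {n} j {a b} → a < b → ∀ {lo hi : Fin n → ℚ} → lo ≪[ j ] hi →
  updateAt lo j (λ _ → a) ≪ updateAt hi j (λ _ → b)
updateAt-≪ j {a} {b} a<b {lo} {hi} lo≪hi c with c ≟ j
... | yes refl rewrite updateAt-updates j {λ _ → a} lo | updateAt-updates j {λ _ → b} hi = a<b
... | no c≢j rewrite updateAt-minimal c j {λ _ → a} lo c≢j | updateAt-minimal c j {λ _ → b} hi c≢j =
  lo≪hi c c≢j

≪⇒<ₚ : ∀ {m} {x y : Pt (ℕ.suc m)} → lookup x ≪ lookup y → x <ₚ y
≪⇒<ₚ x≪y = (λ c → ℚ.<⇒≤ (x≪y c)) , λ { refl → ℚ.<-irrefl refl (x≪y zero) }

_<ₗₑₓ_ : ∀ {n} → Vec ℚ n → Vec ℚ n → Set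
_<ₗₑₓ_ = Lex-< _≡_ _<_

module <ₗₑₓ (n : ℕ) = StrictTotalOrder (Lex.<-strictTotalOrder ℚ.<-strictTotalOrder n)

<ₗₑₓ-irrefl : ∀ {n} {xs : Vec ℚ n} → ¬ xs <ₗₑₓ xs
<ₗₑₓ-irrefl {n} = <ₗₑₓ.irrefl n (≡⇒Pointwise-≡ refl)

<ₗₑₓ-total : ∀ {n} {xs ys : Vec ℚ n} → xs ≢ ys → xs <ₗₑₓ ys ⊎ ys <ₗₑₓ xs
<ₗₑₓ-total {n} {xs} {ys} xs≢ys with <ₗₑₓ.compare n xs ys
... | tri< xs<ys _ _ = inj₁ xs<ys
... | tri≈ _ xs≋ys _ = contradiction (Pointwise-≡⇒≡ xs≋ys) xs≢ys
... | tri> _ _ ys<xs = inj₂ ys<xs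

≤-pointwise⇒<ₗₑₓ : ∀ {n} {xs ys : Vec ℚ n} →
  (∀ c → lookup xs c ≤ℚ lookup ys c) → xs ≢ ys → xs <ₗₑₓ ys
≤-pointwise⇒<ₗₑₓ {xs = []} {[]} _ []≢[] = contradiction refl []≢[]
≤-pointwise⇒<ₗₑₓ {xs = x ∷ xs} {y ∷ ys} xs≤ys xs≢ys with ℚ.<-cmp x y
... | tri< x<y _ _ = this x<y refl
... | tri≈ _ refl _ = next refl (≤-pointwise⇒<ₗₑₓ (xs≤ys ∘ suc) (xs≢ys ∘ cong (x ∷_)))
... | tri> _ _ y<x = contradiction (xs≤ys zero) (<⇒≱ y<x)

<ₗₑₓ-head : ∀ {n x y} {xs ys : Vec ℚ n} → (x ∷ xs) <ₗₑₓ (y ∷ ys) → x ≤ℚ y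
<ₗₑₓ-head (this x<y _) = ℚ.<⇒≤ x<y
<ₗₑₓ-head (next refl _) = ℚ.≤-refl

LexFrom : ∀ {n} → Fin n → PtRel n
LexFrom k x y = (lookup x k ∷ x) <ₗₑₓ (lookup y k ∷ y)

LexFrom-isLinearOrder : ∀ {n} (k : Fin n) → IsLinearOrderOn Full (LexFrom k)
LexFrom-isLinearOrder {n} k =
    (λ _ _ → <ₗₑₓ-irrefl)
  , (λ _ _ _ _ _ _ → <ₗₑₓ.trans (ℕ.suc n))
  , (λ _ _ _ _ x≢y → <ₗₑₓ-total (x≢y ∘ ∷-injectiveʳ))

<⇒LexFrom : ∀ {n} {k : Fin n} {x y} → lookup x k < lookup y k → LexFrom k x y
<⇒LexFrom xₖ<yₖ = this xₖ<yₖ refl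

<ₚ⇔LexFrom : ∀ {m} (x y : Pt (ℕ.suc m)) → x <ₚ y ⇔ (∀ k → LexFrom k x y)
<ₚ⇔LexFrom x y = mk⇔
  (λ { (x≤y , x≢y) k → ≤-pointwise⇒<ₗₑₓ (λ { zero → x≤y k ; (suc c) → x≤y c }) (x≢y ∘ ∷-injectiveʳ) })
  (λ x<y → (λ c → <ₗₑₓ-head (x<y c)) , λ { refl → <ₗₑₓ-irrefl (x<y zero) })

module DenseSubset {n : ℕ} (D : Subset n) (dense : Dense D) where

  Point : Set
  Point = Σ (Pt n) D

  coord : Point → Fin n → ℚ
  coord (x , _) = lookup x

  point-in-box : ∀ {lo hi} → lo ≪ hi → Σ[ x ∈ Point ] (lo ≪ coord x × coord x ≪ hi)
  point-in-box {lo} {hi} lo≪hi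
    with x , x∈D , x∈box ← dense (tabulate lo) (tabulate hi)
           (λ c → subst₂ _<_ (sym (lookup∘tabulate lo c)) (sym (lookup∘tabulate hi c)) (lo≪hi c))
    = (x , x∈D)
    , (λ c → subst (_< lookup x c) (lookup∘tabulate lo c) (proj₁ (x∈box c)))
    , (λ c → subst (lookup x c <_) (lookup∘tabulate hi c) (proj₂ (x∈box c)))

  point-in-box-at : ∀ j {a b} → a < b → ∀ {lo hi} → lo ≪[ j ] hi →
    Σ[ x ∈ Point ] (a < coord x j × coord x j < b × lo ≪[ j ] coord x × coord x ≪[ j ] hi)
  point-in-box-at j {a} {b} a<b {lo} {hi} lo≪hi
    with x , lo′≪x , x≪hi′ ← point-in-box (updateAt-≪ j a<b lo≪hi)
    = x
    , subst (_< coord x j) (updateAt-updates j lo) (lo′≪x j)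
    , subst (coord x j <_) (updateAt-updates j hi) (x≪hi′ j)
    , (λ c c≢j → subst (_< coord x c) (updateAt-minimal c j lo c≢j) (lo′≪x c))
    , (λ c c≢j → subst (coord x c <_) (updateAt-minimal c j hi c≢j) (x≪hi′ c))

  record Inversion (j : Fin n) (lo hi : ℚ) (B T : Fin n → ℚ) : Set where
    field
      d e : Point
      lo<eⱼ : lo < coord e j
      eⱼ<dⱼ : coord e j < coord d j
      dⱼ<hi : coord d j < hi
      d≪B : coord d ≪[ j ] B
      T≪e : T ≪[ j ] coord e

  inversion : ∀ j {lo hi} → lo < hi → ∀ B T → Inversion j lo hi B T
  inversion j lo<hi B T =
    let mid , lo<mid , mid<hi = ℚ.<-dense lo<hi
        d , mid<dⱼ , dⱼ<hi , _ , d≪B = point-in-box-at j mid<hi (λ c _ → p-1<p (B c))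
        e , lo<eⱼ , eⱼ<mid , T≪e , _ = point-in-box-at j lo<mid (λ c _ → p<p+1 (T c))
    in record { d = d ; e = e ; lo<eⱼ = lo<eⱼ ; eⱼ<dⱼ = ℚ.<-trans eⱼ<mid mid<dⱼ
              ; dⱼ<hi = dⱼ<hi ; d≪B = d≪B ; T≪e = T≪e }

  record Window (L U : Fin n → ℚ) (k : Fin n) : Set where
    field
      toInversion : Inversion k (L k) (U k) (L ⊓ᶠ U) (L ⊔ᶠ U)
    open Inversion toInversion public

  window : ∀ {L U} k → L k < U k → Window L U k
  window k Lₖ<Uₖ = record { toInversion = inversion k Lₖ<Uₖ _ _ }

  module _ {L U k} (W : Window L U k) where
    open Window W

    window-L≪e : L ≪ coord e
    window-L≪e c with c ≟ k
    ... | yes refl = lo<eⱼ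
    ... | no c≢k = ℚ.≤-<-trans (ℚ.p≤p⊔q (L c) (U c)) (T≪e c c≢k)

    window-d≪U : coord d ≪ U
    window-d≪U c with c ≟ k
    ... | yes refl = dⱼ<hi
    ... | no c≢k = ℚ.<-≤-trans (d≪B c c≢k) (ℚ.p⊓q≤q (L c) (U c))

    window-d≪L : coord d ≪[ k ] L
    window-d≪L c c≢k = ℚ.<-≤-trans (d≪B c c≢k) (ℚ.p⊓q≤p (L c) (U c))

    window-d≪e : coord d ≪[ k ] coord e
    window-d≪e c c≢k = ℚ.<-trans (window-d≪L c c≢k) (window-L≪e c)

  window-cross : ∀ {L U k k′} → k ≢ k′ → (W : Window L U k) (W′ : Window L U k′) →
    coord (Window.d W) ≪ coord (Window.e W′)
  window-cross {L} {U} {k} k≢k′ W W′ c with c ≟ k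
  ... | yes refl = ℚ.<-trans (window-d≪U W c) (ℚ.≤-<-trans (ℚ.p≤q⊔p (L c) (U c)) (Window.T≪e W′ c k≢k′))
  ... | no c≢k = ℚ.<-trans (window-d≪L W c c≢k) (window-L≪e W′ c)

module Realizer {m : ℕ} (D : Subset (ℕ.suc m)) (dense : Dense D)
  (≺ : Fin (ℕ.suc m) → PtRel (ℕ.suc m)) (≺-linear : ∀ i → IsLinearOrderOn D (≺ i))
  (≺-realizes : ∀ x y → D x → D y → (x <ₚ y ⇔ (∀ i → ≺ i x y))) where

  open DenseSubset D dense

  N : ℕ
  N = ℕ.suc m

  record _≺⟨_⟩_ (x : Point) (i : Fin N) (y : Point) : Set where
    constructor ⟪_⟫
    field unwrap : ≺ i (proj₁ x) (proj₁ y)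

  ≺-irrefl : ∀ {i} (x : Point) → ¬ x ≺⟨ i ⟩ x
  ≺-irrefl {i} (x , x∈D) ⟪ x≺x ⟫ = proj₁ (≺-linear i) x x∈D x≺x

  ≺-trans : ∀ {i} {x y z : Point} → x ≺⟨ i ⟩ y → y ≺⟨ i ⟩ z → x ≺⟨ i ⟩ z
  ≺-trans {i} {x , x∈D} {y , y∈D} {z , z∈D} ⟪ x≺y ⟫ ⟪ y≺z ⟫ =
    ⟪ proj₁ (proj₂ (≺-linear i)) x y z x∈D y∈D z∈D x≺y y≺z ⟫

  ≺-asym : ∀ {i} {x y : Point} → x ≺⟨ i ⟩ y → ¬ y ≺⟨ i ⟩ x
  ≺-asym {x = x} x≺y y≺x = ≺-irrefl x (≺-trans x≺y y≺x)

  ≺-total : ∀ {i} {x y : Point} → proj₁ x ≢ proj₁ y → x ≺⟨ i ⟩ y ⊎ y ≺⟨ i ⟩ x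
  ≺-total {i} {x , x∈D} {y , y∈D} x≢y =
    ⊎.map ⟪_⟫ ⟪_⟫ (proj₂ (proj₂ (≺-linear i)) x y x∈D y∈D x≢y)

  ≪⇒≺ : ∀ {i} {x y : Point} → coord x ≪ coord y → x ≺⟨ i ⟩ y
  ≪⇒≺ {i} {x , x∈D} {y , y∈D} x≪y = ⟪ Equivalence.to (≺-realizes x y x∈D y∈D) (≪⇒<ₚ x≪y) i ⟫

  reversing-order : ∀ (x y : Point) c → coord y c < coord x c → ∃[ i ] y ≺⟨ i ⟩ x
  reversing-order x@(x′ , x∈D) y@(y′ , y∈D) c yc<xc =
    let i , x⊀y = ¬∀⟶∃¬ N (λ i → x ≺⟨ i ⟩ y) ≺? ¬x<ₚy
    in i , [ ⊥-elim ∘ x⊀y , id ]′ (≺-total x≢y)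
    where
    ¬x<ₚy : ¬ (∀ i → x ≺⟨ i ⟩ y)
    ¬x<ₚy x≺y = <⇒≱ yc<xc (proj₁ (Equivalence.from (≺-realizes x′ y′ x∈D y∈D) (_≺⟨_⟩_.unwrap ∘ x≺y)) c)
    x≢y : x′ ≢ y′
    x≢y refl = ℚ.<-irrefl refl yc<xc
    ≺? : ∀ i → Dec (x ≺⟨ i ⟩ y)
    ≺? i = [ yes , no ∘ ≺-asym ]′ (≺-total x≢y)

  reversed : ∀ {j lo hi B T} (I : Inversion j lo hi B T) → ∃[ i ] Inversion.e I ≺⟨ i ⟩ Inversion.d I
  reversed {j} I = reversing-order (Inversion.d I) (Inversion.e I) j (Inversion.eⱼ<dⱼ I)

  ¬interlocked : ∀ {i} {d e f g : Point} → e ≺⟨ i ⟩ d → g ≺⟨ i ⟩ f →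
    coord d ≪ coord g → coord f ≪ coord e → ⊥
  ¬interlocked {e = e} e≺d g≺f d≪g f≪e =
    ≺-irrefl e (≺-trans (≺-trans (≺-trans e≺d (≪⇒≺ d≪g)) g≺f) (≪⇒≺ f≪e))

  -- If i ≢ i′, the windows between L and U at the m coordinates k ≢ j are reversed by m orders
  -- that are pairwise distinct (windows at different coordinates interlock) and different from
  -- i and i′ (the windows interlock with (d , e) and (d′ , e′)): m + 2 distinct orders among m + 1.
  reverser-unique : ∀ j {d e d′ e′ : Point} {i i′} →
    (coord d ⊔ᶠ coord d′) ≪[ j ] (coord e ⊓ᶠ coord e′) →
    e ≺⟨ i ⟩ d → e′ ≺⟨ i′ ⟩ d′ → i ≡ i′
  reverser-unique j {d} {e} {d′} {e′} {i} {i′} L≪U e≺d e′≺d′ =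
    decidable-stable (i ≟ i′) λ i≢i′ →
      let x , hx≡i′ = injective⇒surjective i∷r-injective i′
      in i∷r-misses-i′ i≢i′ x hx≡i′
    where
    L U : Fin N → ℚ
    L = coord d ⊔ᶠ coord d′
    U = coord e ⊓ᶠ coord e′

    W : ∀ k → Window L U (punchIn j k)
    W k = window (punchIn j k) (L≪U (punchIn j k) (punchInᵢ≢i j k))

    r : Fin m → Fin N
    r k = proj₁ (reversed (Window.toInversion (W k)))

    r-reverses : ∀ k → Window.e (W k) ≺⟨ r k ⟩ Window.d (W k)
    r-reverses k = proj₂ (reversed (Window.toInversion (W k)))

    outer≢r : ∀ {a b : Point} {t} → (∀ c → coord a c ≤ℚ L c) → (∀ c → U c ≤ℚ coord b c) →
      b ≺⟨ t ⟩ a → ∀ k → t ≢ r k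
    outer≢r a≤L U≤b b≺a k refl =
      ¬interlocked b≺a (r-reverses k)
        (λ c → ℚ.≤-<-trans (a≤L c) (window-L≪e (W k) c))
        (λ c → ℚ.<-≤-trans (window-d≪U (W k) c) (U≤b c))

    r-injective : Injective _≡_ _≡_ r
    r-injective {k} {k′} rk≡rk′ = decidable-stable (k ≟ k′) λ k≢k′ →
      let jk≢jk′ = k≢k′ ∘ punchIn-injective j k k′
      in ¬interlocked (r-reverses k)
           (subst (λ t → Window.e (W k′) ≺⟨ t ⟩ Window.d (W k′)) (sym rk≡rk′) (r-reverses k′))
           (window-cross jk≢jk′ (W k) (W k′)) (window-cross (jk≢jk′ ∘ sym) (W k′) (W k))

    i∷r : Fin N → Fin N
    i∷r zero = i
    i∷r (suc k) = r k

    i≢r : ∀ k → i ≢ r k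
    i≢r = outer≢r (λ c → ℚ.p≤p⊔q (coord d c) _) (λ c → ℚ.p⊓q≤p (coord e c) _) e≺d

    i∷r-injective : Injective _≡_ _≡_ i∷r
    i∷r-injective {zero} {zero} _ = refl
    i∷r-injective {zero} {suc k′} i≡rk′ = contradiction i≡rk′ (i≢r k′)
    i∷r-injective {suc k} {zero} rk≡i = contradiction (sym rk≡i) (i≢r k)
    i∷r-injective {suc k} {suc k′} rk≡rk′ = cong suc (r-injective rk≡rk′)

    i∷r-misses-i′ : i ≢ i′ → ∀ x → i∷r x ≢ i′
    i∷r-misses-i′ i≢i′ zero = i≢i′
    i∷r-misses-i′ _ (suc k) rk≡i′ =
      outer≢r (λ c → ℚ.p≤q⊔p (coord d c) _) (λ c → ℚ.p⊓q≤q (coord e c) _) e′≺d′ k (sym rk≡i′)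

  nested-reverser-unique : ∀ j {d e d′ e′ : Point} {i i′} →
    coord d′ ≪[ j ] coord d → coord d ≪[ j ] coord e → coord e ≪[ j ] coord e′ →
    e ≺⟨ i ⟩ d → e′ ≺⟨ i′ ⟩ d′ → i ≡ i′
  nested-reverser-unique j d′≪d d≪e e≪e′ = reverser-unique j λ c c≢j →
    let d<e = d≪e c c≢j
        d′<e = ℚ.<-trans (d′≪d c c≢j) d<e
    in ⊔-< (<-⊓ d<e (ℚ.<-trans d<e (e≪e′ c c≢j))) (<-⊓ d′<e (ℚ.<-trans d′<e (e≪e′ c c≢j)))

  reference : ∀ j → Window (λ _ → 0ℚ) (λ _ → 1ℚ) j
  reference j = window j (ℚ.positive⁻¹ 1ℚ)

  σ : Fin N → Fin N
  σ j = proj₁ (reversed (Window.toInversion (reference j)))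

  σ-reverses : ∀ j {d e : Point} → coord e j < coord d j → coord d ≪[ j ] coord e → e ≺⟨ σ j ⟩ d
  σ-reverses j {d} {e} eⱼ<dⱼ d≪e =
    let i , e≺d = reversing-order d e j eⱼ<dⱼ
        i″ , e″≺d″ = reversed I
        i≡i″ = nested-reverser-unique j d″≪d d≪e e≪e″ e≺d e″≺d″
        σj≡i″ = nested-reverser-unique j d″≪d₀ (window-d≪e ref) e₀≪e″ e₀≺d₀ e″≺d″
    in subst (λ t → e ≺⟨ t ⟩ d) (trans i≡i″ (sym σj≡i″)) e≺d
    where
    ref = reference j
    open Window ref using () renaming (d to d₀; e to e₀)
    I = inversion j eⱼ<dⱼ (coord d ⊓ᶠ coord d₀) (coord e ⊔ᶠ coord e₀)
    open Inversion I using (d≪B; T≪e) renaming (d to d″; e to e″)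

    e₀≺d₀ : e₀ ≺⟨ σ j ⟩ d₀
    e₀≺d₀ = proj₂ (reversed (Window.toInversion ref))

    d″≪d : coord d″ ≪[ j ] coord d
    d″≪d c c≢j = ℚ.<-≤-trans (d≪B c c≢j) (ℚ.p⊓q≤p (coord d c) _)
    d″≪d₀ : coord d″ ≪[ j ] coord d₀
    d″≪d₀ c c≢j = ℚ.<-≤-trans (d≪B c c≢j) (ℚ.p⊓q≤q (coord d c) _)
    e≪e″ : coord e ≪[ j ] coord e″
    e≪e″ c c≢j = ℚ.≤-<-trans (ℚ.p≤p⊔q (coord e c) _) (T≪e c c≢j)
    e₀≪e″ : coord e₀ ≪[ j ] coord e″
    e₀≪e″ c c≢j = ℚ.≤-<-trans (ℚ.p≤q⊔p (coord e c) _) (T≪e c c≢j)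

  σ-respects : ∀ j {a b : Point} → coord a j < coord b j → a ≺⟨ σ j ⟩ b
  σ-respects j {a} {b} aⱼ<bⱼ = ≺-trans (≺-trans a≺e e≺d) d≺b
    where
    W : Window (coord a) (coord b) j
    W = window j aⱼ<bⱼ
    open Window W using (d; e)
    a≺e : a ≺⟨ σ j ⟩ e
    a≺e = ≪⇒≺ (window-L≪e W)
    e≺d : e ≺⟨ σ j ⟩ d
    e≺d = σ-reverses j (Window.eⱼ<dⱼ W) (window-d≪e W)
    d≺b : d ≺⟨ σ j ⟩ b
    d≺b = ≪⇒≺ (window-d≪U W)

  σ-injective : Injective _≡_ _≡_ σ
  σ-injective {j} {k} σj≡σk = decidable-stable (j ≟ k) λ j≢k →
    ≺-asym (subst (λ t → d₀ ≺⟨ t ⟩ e₀) (sym σj≡σk) (σ-respects k (window-d≪e ref k (j≢k ∘ sym))))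
           (σ-reverses j (Window.eⱼ<dⱼ ref) (window-d≪e ref))
    where
    ref = reference j
    open Window ref using () renaming (d to d₀; e to e₀)

  σ-surjective : ∀ i → ∃[ j ] σ j ≡ i
  σ-surjective = injective⇒surjective σ-injective

  -- Opaque, so that the pigeonhole search defining τ is never unfolded during type checking.
  opaque
    τ : Fin N → Fin N
    τ i = proj₁ (σ-surjective i)

    σ∘τ : ∀ i → σ (τ i) ≡ i
    σ∘τ i = proj₂ (σ-surjective i)

  ≺* : Fin N → PtRel N
  ≺* i = LexFrom (τ i)

  ≺*-isLinearOrder : ∀ i → IsLinearOrderOn Full (≺* i)
  ≺*-isLinearOrder i = LexFrom-isLinearOrder (τ i)

  ≺*-extends : NoTwoColinear D → ∀ i x y → D x → D y → ≺ i x y → ≺* i x y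
  ≺*-extends noColinear i x y x∈D y∈D x≺y with ℚ.<-cmp (lookup x (τ i)) (lookup y (τ i))
  ... | tri< xₖ<yₖ _ _ = <⇒LexFrom xₖ<yₖ
  ... | tri≈ _ xₖ≡yₖ _ = ⊥-elim (noColinear x y x∈D y∈D x≢y (τ i , xₖ≡yₖ))
    where
    x≢y : x ≢ y
    x≢y refl = proj₁ (≺-linear i) x x∈D x≺y
  ... | tri> _ _ yₖ<xₖ = ⊥-elim (≺-asym x≺ᵢy y≺ᵢx)
    where
    x≺ᵢy : (x , x∈D) ≺⟨ i ⟩ (y , y∈D)
    x≺ᵢy = ⟪ x≺y ⟫
    y≺ᵢx : (y , y∈D) ≺⟨ i ⟩ (x , x∈D)
    y≺ᵢx = subst (λ t → (y , y∈D) ≺⟨ t ⟩ (x , x∈D)) (σ∘τ i) (σ-respects (τ i) yₖ<xₖ)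

  ≺*-realizes : ∀ x y → x <ₚ y ⇔ (∀ i → ≺* i x y)
  ≺*-realizes x y = mk⇔
    (λ x<y i → Equivalence.to (<ₚ⇔LexFrom x y) x<y (τ i))
    (λ x≺*y → Equivalence.from (<ₚ⇔LexFrom x y) λ k →
       subst (λ t → LexFrom t x y) (σ-injective (σ∘τ (σ k))) (x≺*y (σ k)))

lemma6p4 : (n : ℕ) → 2 ≤ n → (D : Subset n) → Dense D → NoTwoColinear D →
    (≺ : Fin n → PtRel n) →
    (∀ i → IsLinearOrderOn D (≺ i)) →
    (∀ x y → D x → D y → (x <ₚ y ⇔ (∀ i → ≺ i x y))) →
    Σ[ ≺* ∈ (Fin n → PtRel n) ]
      ((∀ i → IsLinearOrderOn Full (≺* i))
      × (∀ i x y → D x → D y → ≺ i x y → ≺* i x y)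
      × (∀ x y → (x <ₚ y ⇔ (∀ i → ≺* i x y))))
lemma6p4 ℕ.zero () D
lemma6p4 (ℕ.suc m) _ D dense noColinear ≺ ≺-linear ≺-realizes =
  ≺* , ≺*-isLinearOrder , ≺*-extends noColinear , ≺*-realizes
  where open Realizer D dense ≺ ≺-linear ≺-realizes
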